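{- If $G$ is a triangle-free finite simple graph of order $n$ and $k$ is a positive integer (with $k<n$), then $\mathcal{M}_k(G)\cong \mathcal{B}_{n-k}(\overline{G})$, where $\overline{G}$ is the complement of $G$.
   Context: For a matching $M\subseteq E(G)$, $G\langle M\rangle$ denotes the spanning subgraph of $G$ with vertex set $V(G)$ and edge set $M$. The matching reconfiguration graph $\mathcal{M}_k(G)$ has as vertices all matchings of $G$ of size at least $k$; two distinct matchings $M_1,M_2$ are adjacent iff there is $v\in V(G)$ with $G\langle M_1\rangle-v=G\langle M_2\rangle-v$. A stable $j$-partition of a graph $H$ is a multiset of $j$ independent sets of $H$ (some possibly empty) partitioning $V(H)$; for $v$, $P-v$ is obtained by deleting $v$ from its part. The Bell $j$-coloring graph $\mathcal{B}_j(H)$ has vertex set the stable $j$-partitions of $H$, distinct $P,Q$ adjacent iff $P-v=Q-v$ for some $v\in V(H)$. -}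

module Defs where

open import Data.Nat using (ℕ; _<_; _≤_; _≥_) renaming (_<ᵇ_ to _<ᵇℕ_)
open import Data.Fin using (Fin; toℕ; _≟_)
open import Data.Bool using (Bool; true; false; not; _∧_; if_then_else_)
open import Data.Vec using (Vec; lookup)
open import Data.List using (List; map; allFin)
open import Data.Nat.ListAction using (sum)
open import Data.Product using (Σ; ∃; _×_; _,_)
open import Relation.Binary.PropositionalEquality using (_≡_; _≢_)
open import Relation.Nullary using (¬_)
open import Relation.Nullary.Decidable using (⌊_⌋)
open import Data.Empty using (⊥; ⊥-elim)
open import Function.Bundles using (_⇔_)

record SimpleGraph (n : ℕ) : Set where
  field
    adj   : Fin n → Fin n → Bool
    adj-sym    : ∀ a b → adj a b ≡ adj b a
    adj-irrefl : ∀ a → adj a a ≡ false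
open SimpleGraph public

TriangleFree : ∀ {n} → SimpleGraph n → Set
TriangleFree G = ∀ a b c → adj G a b ≡ true → adj G b c ≡ true → adj G a c ≡ true → ⊥

complement : ∀ {n} → SimpleGraph n → SimpleGraph n
complement {n} G = record
  { adj = λ a b → not (adj G a b) ∧ not ⌊ a ≟ b ⌋
  ; adj-sym = symP
  ; adj-irrefl = irr }
  where
  open import Relation.Binary.PropositionalEquality using (refl; sym; cong)
  open import Relation.Nullary using (yes; no)
  eqb-sym : ∀ (a b : Fin n) → ⌊ a ≟ b ⌋ ≡ ⌊ b ≟ a ⌋
  eqb-sym a b with a ≟ b | b ≟ a
  ... | yes _ | yes _ = refl
  ... | no _ | no _ = refl
  ... | yes p | no q = ⊥-elim (q (sym p))
  ... | no p | yes q = ⊥-elim (p (sym q))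
  symP : ∀ a b → (not (adj G a b) ∧ not ⌊ a ≟ b ⌋) ≡ (not (adj G b a) ∧ not ⌊ b ≟ a ⌋)
  symP a b rewrite adj-sym G a b | eqb-sym a b = refl
  irr : ∀ a → (not (adj G a a) ∧ not ⌊ a ≟ a ⌋) ≡ false
  irr a with a ≟ a
  ... | yes _ = Data.Bool.Properties.∧-zeroʳ (not (adj G a a))
    where import Data.Bool.Properties
  ... | no p = ⊥-elim (p refl)

-- Boolean n×n matrices, used to encode edge sets / "same part" relations.
Mat : ℕ → Set
Mat n = Vec (Vec Bool n) n

entry : ∀ {n} → Mat n → Fin n → Fin n → Bool
entry M a b = lookup (lookup M a) b

IsMatching : ∀ {n} → SimpleGraph n → Mat n → Set
IsMatching G M =
  (∀ a b → entry M a b ≡ entry M b a) ×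
  (∀ a b → entry M a b ≡ true → adj G a b ≡ true) ×
  (∀ a b c → entry M a b ≡ true → entry M a c ≡ true → b ≡ c)

size : ∀ {n} → Mat n → ℕ
size {n} M = sum (map (λ a → sum (map (λ b →
  if (toℕ a <ᵇℕ toℕ b) ∧ entry M a b then 1 else 0) (allFin n))) (allFin n))

AgreeOff : ∀ {n} → Fin n → Mat n → Mat n → Set
AgreeOff v A B = ∀ a b → a ≢ v → b ≢ v → entry A a b ≡ entry B a b

-- A stable j-partition of H, encoded by its "same part" relation R:
-- R is the kernel of some assignment c of the vertices to j (labelled) parts,
-- each part being an independent set of H.  (Empty parts of the multiset are
-- the unused labels; forgetting the labels gives exactly the multiset.)
IsStablePartition : ∀ {n} → SimpleGraph n → ℕ → Mat n → Set
IsStablePartition {n} H j R =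
  Σ (Fin n → Fin j) λ c →
    (∀ a b → (entry R a b ≡ true) ⇔ (c a ≡ c b)) ×
    (∀ a b → c a ≡ c b → adj H a b ≡ false)

record Graph : Set₁ where
  field
    V   : Set
    _≈_ : V → V → Set
    Adj : V → V → Set

record _≅_ (G₁ G₂ : Graph) : Set where
  module A = Graph G₁
  module B = Graph G₂
  field
    to      : A.V → B.V
    from    : B.V → A.V
    to-cong   : ∀ {x y} → x A.≈ y → to x B.≈ to y
    from-cong : ∀ {x y} → x B.≈ y → from x A.≈ from y
    from-to : ∀ x → from (to x) A.≈ x
    to-from : ∀ y → to (from y) B.≈ y
    adj-iff : ∀ x y → A.Adj x y ⇔ B.Adj (to x) (to y)

private
  fst : ∀ {n} {P : Mat n → Set} → Σ (Mat n) P → Mat n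
  fst (M , _) = M

ReconfGraph : ∀ {n} → (Mat n → Set) → Graph
ReconfGraph {n} P = record
  { V = Σ (Mat n) P
  ; _≈_ = λ X Y → fst X ≡ fst Y
  ; Adj = λ X Y → (fst X ≢ fst Y) × ∃ λ (v : Fin n) → AgreeOff v (fst X) (fst Y) }

MatchingGraph : ∀ {n} → SimpleGraph n → ℕ → Graph
MatchingGraph G k = ReconfGraph (λ M → IsMatching G M × size M ≥ k)

BellGraph : ∀ {n} → SimpleGraph n → ℕ → Graph
BellGraph H j = ReconfGraph (IsStablePartition H j)

-- A matching M of G corresponds to the partition whose parts are the edges of M and the
-- unmatched vertices; its "same part" relation is M together with the diagonal.  Any two
-- vertices in a common part of a stable partition of the complement are adjacent in G, so
-- for triangle-free G every part has at most two vertices, and removing the diagonal from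
-- the relation gives back a matching.  Choosing in each part the vertex with no partner
-- above it shows that the partition of M has exactly n - |M| parts, so |M| ≥ k exactly when
-- the partition fits into n - k colours.  Both translations act entrywise on the relation
-- matrices, hence preserve agreement off any vertex, which makes them a graph isomorphism.
module Submission where

open import Defs
import Algebra.Properties.Monoid.Sum
open import Data.Bool using (Bool; true; false; not; _∧_; _∨_; if_then_else_)
import Data.Bool.Properties as Bool
open import Data.Bool.Properties using (¬-not)
open import Data.Empty using (⊥; ⊥-elim)
open import Data.Fin using (Fin; zero; suc; toℕ; inject≤; _≟_)
open import Data.Fin.Properties using (suc-injective; injective⇒≤; inject≤-injective; <-cmp; any?)
import Data.List as List
open import Data.List using (map; allFin)
open import Data.Nat using (ℕ; zero; suc; _+_; _∸_; _≤_; _<_; _<ᵇ_; _≡ᵇ_; z≤n; s≤s)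
open import Data.Nat.ListAction using (sum)
open import Data.Nat.Properties
  using (+-0-monoid; +-suc; m+n∸m≡n; m+n∸n≡m; m∸[m∸n]≡n;
         ≤-trans; ≤-reflexive; ∸-monoʳ-≤; <⇒≤; <⇒<ᵇ; <ᵇ⇒<; <-asym)
open import Data.Product using (Σ; _×_; _,_; proj₁; proj₂)
open import Data.Sum using (_⊎_; inj₁; inj₂; [_,_])
import Data.Vec as Vec
open import Data.Vec.Properties using (lookup∘tabulate)
open import Data.Vec.Relation.Binary.Pointwise.Extensional using (ext; Pointwise-≡⇒≡)
open import Function using (_∘_; id; case_of_)
open import Function.Bundles using (_⇔_; mk⇔; Equivalence)
open import Function.Construct.Composition using (_⇔-∘_)
open import Relation.Binary using (tri<; tri≈; tri>)
open import Relation.Binary.PropositionalEquality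
  using (_≡_; _≢_; refl; sym; trans; cong; subst; subst₂; module ≡-Reasoning)
open import Relation.Nullary using (yes; no)
open import Relation.Nullary.Decidable using (⌊_⌋)

open Algebra.Properties.Monoid.Sum +-0-monoid using (sum-cong-≗) renaming (sum to ∑)
open Equivalence using (to; from)

count : ∀ {n} → (Fin n → Bool) → ℕ
count P = ∑ (λ a → if P a then 1 else 0)

sum-map-tabulate : ∀ {A : Set} {n} (f : A → ℕ) (g : Fin n → A) →
  sum (map f (List.tabulate g)) ≡ ∑ (f ∘ g)
sum-map-tabulate {n = zero}  f g = refl
sum-map-tabulate {n = suc n} f g = cong (f (g zero) +_) (sum-map-tabulate f (g ∘ suc))

sum-map-allFin : ∀ n (f : Fin n → ℕ) → sum (map f (allFin n)) ≡ ∑ f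
sum-map-allFin n f = sum-map-tabulate f id

≡ᵇ0⇔≡0 : ∀ m → (m ≡ᵇ 0) ≡ true ⇔ m ≡ 0
≡ᵇ0⇔≡0 zero    = mk⇔ (λ _ → refl) (λ _ → refl)
≡ᵇ0⇔≡0 (suc m) = mk⇔ (λ ()) (λ ())

count≡0⇔all-false : ∀ {n} (P : Fin n → Bool) → count P ≡ 0 ⇔ (∀ a → P a ≡ false)
count≡0⇔all-false {zero}  P = mk⇔ (λ _ ()) (λ _ → refl)
count≡0⇔all-false {suc n} P with P zero in P₀ | count≡0⇔all-false (P ∘ suc)
... | true  | _  = mk⇔ (λ ()) (λ all-false → case trans (sym P₀) (all-false zero) of λ ())
... | false | ih = mk⇔ (λ count≡0 → λ { zero → P₀ ; (suc a) → to ih count≡0 a })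
                      (λ all-false → from ih (all-false ∘ suc))

count≤1 : ∀ {n} (P : Fin n → Bool) →
  (∀ a b → P a ≡ true → P b ≡ true → a ≡ b) → count P ≤ 1
count≤1 {zero}  P unique = z≤n
count≤1 {suc n} P unique with P zero in P₀
... | true  = s≤s (≤-reflexive (from (count≡0⇔all-false (P ∘ suc)) rest-false))
  where
  rest-false : ∀ a → P (suc a) ≡ false
  rest-false a = ¬-not {y = true} λ Pa → case unique zero (suc a) P₀ Pa of λ ()
... | false = count≤1 (P ∘ suc) (λ a b Pa Pb → suc-injective (unique (suc a) (suc b) Pa Pb))

count-zeros+∑ : ∀ {n} (f : Fin n → ℕ) → (∀ a → f a ≤ 1) →
  count (λ a → f a ≡ᵇ 0) + ∑ f ≡ n
count-zeros+∑ {zero}  f f≤1 = refl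
count-zeros+∑ {suc n} f f≤1 with f zero | f≤1 zero | count-zeros+∑ (f ∘ suc) (f≤1 ∘ suc)
... | 0           | _      | ih = cong suc ih
... | 1           | _      | ih = trans (+-suc _ _) (cong suc ih)
... | suc (suc _) | s≤s () | _

record Enumeration {n} (P : Fin n → Bool) (m : ℕ) : Set where
  field
    enum           : Fin m → Fin n
    enum-injective : ∀ {i j} → enum i ≡ enum j → i ≡ j
    enum-sound     : ∀ i → P (enum i) ≡ true
    rank           : ∀ a → P a ≡ true → Fin m
    enum-rank      : ∀ a Pa → enum (rank a Pa) ≡ a

  rank-injective : ∀ {a b} Pa Pb → rank a Pa ≡ rank b Pb → a ≡ b
  rank-injective {a} {b} Pa Pb eq = trans (sym (enum-rank a Pa)) (trans (cong enum eq) (enum-rank b Pb))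

  rank-cong : ∀ {a b} Pa Pb → a ≡ b → rank a Pa ≡ rank b Pb
  rank-cong {a} {b} Pa Pb a≡b = enum-injective (trans (enum-rank a Pa) (trans a≡b (sym (enum-rank b Pb))))

enumerate : ∀ {n} (P : Fin n → Bool) → Enumeration P (count P)
enumerate {zero}  P = record
  { enum = λ () ; enum-injective = λ { {()} } ; enum-sound = λ () ; rank = λ () ; enum-rank = λ () }
enumerate {suc n} P = extend (P zero) refl (enumerate (P ∘ suc))
  where
  extend : ∀ {m} b → P zero ≡ b → Enumeration (P ∘ suc) m → Enumeration P ((if b then 1 else 0) + m)
  extend true P₀ E = record
    { enum           = λ { zero → zero ; (suc i) → suc (enum i) }
    ; enum-injective = λ { {zero}  {zero}  _  → refl
                         ; {suc i} {suc j} eq → cong suc (enum-injective (suc-injective eq)) }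
    ; enum-sound     = λ { zero → P₀ ; (suc i) → enum-sound i }
    ; rank           = λ { zero _ → zero ; (suc a) Pa → suc (rank a Pa) }
    ; enum-rank      = λ { zero _ → refl ; (suc a) Pa → cong suc (enum-rank a Pa) }
    }
    where open Enumeration E
  extend false P₀ E = record
    { enum           = suc ∘ enum
    ; enum-injective = enum-injective ∘ suc-injective
    ; enum-sound     = enum-sound
    ; rank           = λ { zero P₀′ → case trans (sym P₀) P₀′ of λ ()
                         ; (suc a) Pa → rank a Pa }
    ; enum-rank      = λ { zero P₀′ → case trans (sym P₀) P₀′ of λ ()
                         ; (suc a) Pa → cong suc (enum-rank a Pa) }
    }
    where open Enumeration E

count≤-injectiveOn : ∀ {n j} (P : Fin n → Bool) (c : Fin n → Fin j) →
  (∀ a b → P a ≡ true → P b ≡ true → c a ≡ c b → a ≡ b) → count P ≤ j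
count≤-injectiveOn P c injective =
  injective⇒≤ {f = c ∘ enum} λ eq → enum-injective (injective _ _ (enum-sound _) (enum-sound _) eq)
  where open Enumeration (enumerate P)

tabulate² : ∀ {n} → (Fin n → Fin n → Bool) → Mat n
tabulate² f = Vec.tabulate (Vec.tabulate ∘ f)

entry-tabulate² : ∀ {n} (f : Fin n → Fin n → Bool) a b → entry (tabulate² f) a b ≡ f a b
entry-tabulate² f a b rewrite lookup∘tabulate (Vec.tabulate ∘ f) a = lookup∘tabulate (f a) b

Mat-ext : ∀ {n} {A B : Mat n} → (∀ a b → entry A a b ≡ entry B a b) → A ≡ B
Mat-ext eq = Pointwise-≡⇒≡ (ext λ a → Pointwise-≡⇒≡ (ext (eq a)))

pointwise : ∀ {n} → (Fin n → Fin n → Bool → Bool) → Mat n → Mat n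
pointwise φ A = tabulate² λ a b → φ a b (entry A a b)

pointwise-agreeOff : ∀ {n} (φ : Fin n → Fin n → Bool → Bool) v A B →
  AgreeOff v A B → AgreeOff v (pointwise φ A) (pointwise φ B)
pointwise-agreeOff φ v A B agree a b a≢v b≢v = begin
  entry (pointwise φ A) a b ≡⟨ entry-tabulate² _ a b ⟩
  φ a b (entry A a b)       ≡⟨ cong (φ a b) (agree a b a≢v b≢v) ⟩
  φ a b (entry B a b)       ≡⟨ entry-tabulate² _ a b ⟨
  entry (pointwise φ B) a b ∎
  where open ≡-Reasoning

pointwise-inverse : ∀ {n} (φ ψ : Fin n → Fin n → Bool → Bool) {A} →
  (∀ a b → φ a b (ψ a b (entry A a b)) ≡ entry A a b) → pointwise φ (pointwise ψ A) ≡ A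
pointwise-inverse φ ψ inverse = Mat-ext λ a b →
  trans (entry-tabulate² _ a b) (trans (cong (φ a b) (entry-tabulate² _ a b)) (inverse a b))

orDiagonal andOffDiagonal : ∀ {n} → Fin n → Fin n → Bool → Bool
orDiagonal     a b x = x ∨ ⌊ a ≟ b ⌋
andOffDiagonal a b x = x ∧ not ⌊ a ≟ b ⌋

addDiagonal removeDiagonal : ∀ {n} → Mat n → Mat n
addDiagonal    = pointwise orDiagonal
removeDiagonal = pointwise andOffDiagonal

entry-addDiagonal : ∀ {n} (M : Mat n) a b →
  entry (addDiagonal M) a b ≡ true ⇔ (entry M a b ≡ true ⊎ a ≡ b)
entry-addDiagonal M a b rewrite entry-tabulate² (λ a b → orDiagonal a b (entry M a b)) a b
  with entry M a b | a ≟ b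
... | true  | _       = mk⇔ (λ _ → inj₁ refl) (λ _ → refl)
... | false | yes a≡b = mk⇔ (λ _ → inj₂ a≡b) (λ _ → refl)
... | false | no a≢b  = mk⇔ (λ ()) [ (λ ()) , (λ a≡b → ⊥-elim (a≢b a≡b)) ]

entry-removeDiagonal : ∀ {n} (R : Mat n) a b →
  entry (removeDiagonal R) a b ≡ true ⇔ (entry R a b ≡ true × a ≢ b)
entry-removeDiagonal R a b rewrite entry-tabulate² (λ a b → andOffDiagonal a b (entry R a b)) a b
  with entry R a b | a ≟ b
... | true  | yes a≡b = mk⇔ (λ ()) (λ (_ , a≢b) → ⊥-elim (a≢b a≡b))
... | true  | no a≢b  = mk⇔ (λ _ → refl , a≢b) (λ _ → refl)
... | false | _       = mk⇔ (λ ()) (λ { (() , _) })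

removeDiagonal-addDiagonal : ∀ {n} (M : Mat n) → (∀ a → entry M a a ≡ false) →
  removeDiagonal (addDiagonal M) ≡ M
removeDiagonal-addDiagonal M irreflexive = pointwise-inverse andOffDiagonal orDiagonal cancel
  where
  cancel : ∀ a b → (entry M a b ∨ ⌊ a ≟ b ⌋) ∧ not ⌊ a ≟ b ⌋ ≡ entry M a b
  cancel a b with a ≟ b
  ... | yes refl = trans (Bool.∧-zeroʳ _) (sym (irreflexive a))
  ... | no _     = trans (Bool.∧-identityʳ _) (Bool.∨-identityʳ _)

addDiagonal-removeDiagonal : ∀ {n} (R : Mat n) → (∀ a → entry R a a ≡ true) →
  addDiagonal (removeDiagonal R) ≡ R
addDiagonal-removeDiagonal R reflexive = pointwise-inverse orDiagonal andOffDiagonal cancel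
  where
  cancel : ∀ a b → (entry R a b ∧ not ⌊ a ≟ b ⌋) ∨ ⌊ a ≟ b ⌋ ≡ entry R a b
  cancel a b with a ≟ b
  ... | yes refl = trans (Bool.∨-zeroʳ _) (sym (reflexive a))
  ... | no _     = trans (Bool.∨-identityʳ _) (Bool.∧-identityʳ _)

module Matching {n} (M : Mat n)
  (M-sym : ∀ a b → entry M a b ≡ entry M b a)
  (M-functional : ∀ a b c → entry M a b ≡ true → entry M a c ≡ true → b ≡ c) where

  M-true-sym : ∀ {a b} → entry M a b ≡ true → entry M b a ≡ true
  M-true-sym {a} {b} = trans (M-sym b a)

  -- Literally the summand of `size`.
  above : Fin n → Fin n → Bool
  above a b = (toℕ a <ᵇ toℕ b) ∧ entry M a b

  above-intro : ∀ {a b} → toℕ a < toℕ b → entry M a b ≡ true → above a b ≡ true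
  above-intro {a} {b} a<b ab rewrite ab | Bool.∧-identityʳ (toℕ a <ᵇ toℕ b) =
    to Bool.T-≡ (<⇒<ᵇ a<b)

  above-elim : ∀ {a b} → above a b ≡ true → toℕ a < toℕ b × entry M a b ≡ true
  above-elim {a} {b} _ with toℕ a <ᵇ toℕ b in a<ᵇb | entry M a b
  ... | true | true = <ᵇ⇒< (toℕ a) (toℕ b) (from Bool.T-≡ a<ᵇb) , refl

  above⇒entry : ∀ {a b} → above a b ≡ true → entry M a b ≡ true
  above⇒entry = proj₂ ∘ above-elim

  size≡∑count-above : size M ≡ ∑ (count ∘ above)
  size≡∑count-above =
    trans (sum-map-allFin n _)
          (sum-cong-≗ {n} λ a → sum-map-allFin n (λ b → if above a b then 1 else 0))

  -- Each part {a} or {a, b} of the partition induced by M has exactly one leader.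
  isLeader : Fin n → Bool
  isLeader a = count (above a) ≡ᵇ 0

  isLeader⇔ : ∀ a → isLeader a ≡ true ⇔ (∀ b → above a b ≡ false)
  isLeader⇔ a = count≡0⇔all-false (above a) ⇔-∘ ≡ᵇ0⇔≡0 (count (above a))

  isLeader-not-above : ∀ {a b} → isLeader a ≡ true → above a b ≡ true → ⊥
  isLeader-not-above {a} {b} leader-a ab = case trans (sym ab) (to (isLeader⇔ a) leader-a b) of λ ()

  count-isLeader+size : count isLeader + size M ≡ n
  count-isLeader+size =
    trans (cong (count isLeader +_) size≡∑count-above) (count-zeros+∑ _ count-above≤1)
    where
    count-above≤1 : ∀ a → count (above a) ≤ 1
    count-above≤1 a = count≤1 (above a) λ b c ab ac →
      M-functional a b c (above⇒entry ab) (above⇒entry ac)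

  size≡n∸count-isLeader : size M ≡ n ∸ count isLeader
  size≡n∸count-isLeader =
    trans (sym (m+n∸m≡n (count isLeader) (size M))) (cong (_∸ count isLeader) count-isLeader+size)

  count-isLeader≡n∸size : count isLeader ≡ n ∸ size M
  count-isLeader≡n∸size =
    trans (sym (m+n∸n≡m (count isLeader) (size M))) (cong (_∸ size M) count-isLeader+size)

  isLeader-of-lower-partner : ∀ {a b} → entry M a b ≡ true → toℕ b < toℕ a → isLeader a ≡ true
  isLeader-of-lower-partner {a} {b} ab b<a = from (isLeader⇔ a) λ c → ¬-not {y = true} λ ac →
    let a<c , M-ac = above-elim ac in
    <-asym b<a (subst (λ x → toℕ a < toℕ x) (M-functional a c b M-ac ab) a<c)

  isLeader-separated : ∀ {a b} → isLeader a ≡ true → isLeader b ≡ true →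
    entry M a b ≡ true → a ≡ b
  isLeader-separated {a} {b} leader-a leader-b ab with <-cmp a b
  ... | tri< a<b _ _ = ⊥-elim (isLeader-not-above leader-a (above-intro a<b ab))
  ... | tri≈ _ a≡b _ = a≡b
  ... | tri> _ _ b<a = ⊥-elim (isLeader-not-above leader-b (above-intro b<a (M-true-sym ab)))

  leader : Fin n → Fin n
  leader a with any? (λ b → above a b Bool.≟ true)
  ... | yes (b , _) = b
  ... | no _        = a

  leader-spec : ∀ a → above a (leader a) ≡ true ⊎ (leader a ≡ a × isLeader a ≡ true)
  leader-spec a with any? (λ b → above a b Bool.≟ true)
  ... | yes (_ , ab) = inj₁ ab
  ... | no ∄above    =
    inj₂ (refl , from (isLeader⇔ a) λ b → ¬-not {y = true} λ ab → ∄above (b , ab))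

  leader-isLeader : ∀ a → isLeader (leader a) ≡ true
  leader-isLeader a with leader-spec a
  ... | inj₁ ab =
    let a<b , M-ab = above-elim ab in isLeader-of-lower-partner (M-true-sym M-ab) a<b
  ... | inj₂ (ℓa≡a , leader-a) = subst (λ x → isLeader x ≡ true) (sym ℓa≡a) leader-a

  leader-above : ∀ {a b} → above a b ≡ true → leader a ≡ b
  leader-above {a} ab with leader-spec a
  ... | inj₁ aℓ             = M-functional a _ _ (above⇒entry aℓ) (above⇒entry ab)
  ... | inj₂ (_ , leader-a) = ⊥-elim (isLeader-not-above leader-a ab)

  leader-of-isLeader : ∀ {a} → isLeader a ≡ true → leader a ≡ a
  leader-of-isLeader {a} leader-a with leader-spec a
  ... | inj₁ aℓ         = ⊥-elim (isLeader-not-above leader-a aℓ)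
  ... | inj₂ (ℓa≡a , _) = ℓa≡a

  leader-kernel : ∀ a b → leader a ≡ leader b ⇔ (entry M a b ≡ true ⊎ a ≡ b)
  leader-kernel a b = mk⇔ same-leader⇒related related⇒same-leader
    where
    M-substʳ : ∀ {x y z} → y ≡ z → entry M x y ≡ true → entry M x z ≡ true
    M-substʳ {x} = subst (λ y → entry M x y ≡ true)
    same-leader⇒related : leader a ≡ leader b → entry M a b ≡ true ⊎ a ≡ b
    same-leader⇒related ℓa≡ℓb with leader-spec a | leader-spec b
    ... | inj₁ aℓ | inj₁ bℓ = inj₂ (M-functional (leader b) a b
          (M-true-sym (M-substʳ ℓa≡ℓb (above⇒entry aℓ))) (M-true-sym (above⇒entry bℓ)))
    ... | inj₁ aℓ | inj₂ (ℓb≡b , _) =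
      inj₁ (M-substʳ (trans ℓa≡ℓb ℓb≡b) (above⇒entry aℓ))
    ... | inj₂ (ℓa≡a , _) | inj₁ bℓ =
      inj₁ (M-true-sym (M-substʳ (trans (sym ℓa≡ℓb) ℓa≡a) (above⇒entry bℓ)))
    ... | inj₂ (ℓa≡a , _) | inj₂ (ℓb≡b , _) =
      inj₂ (trans (sym ℓa≡a) (trans ℓa≡ℓb ℓb≡b))
    related⇒same-leader : entry M a b ≡ true ⊎ a ≡ b → leader a ≡ leader b
    related⇒same-leader (inj₂ a≡b) = cong leader a≡b
    related⇒same-leader (inj₁ ab) with <-cmp a b
    ... | tri< a<b _ _ = trans (leader-above (above-intro a<b ab))
                               (sym (leader-of-isLeader (isLeader-of-lower-partner (M-true-sym ab) a<b)))
    ... | tri≈ _ a≡b _ = cong leader a≡b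
    ... | tri> _ _ b<a = trans (leader-of-isLeader (isLeader-of-lower-partner ab b<a))
                               (sym (leader-above (above-intro b<a (M-true-sym ab))))

  colouring : ∀ {j} → count isLeader ≤ j →
    Σ (Fin n → Fin j) λ c → ∀ a b → (entry M a b ≡ true ⊎ a ≡ b) ⇔ (c a ≡ c b)
  colouring leaders≤j = c , λ a b → mk⇔
    (λ related → cong (λ i → inject≤ i leaders≤j)
      (rank-cong (leader-isLeader a) (leader-isLeader b) (from (leader-kernel a b) related)))
    (λ ca≡cb → to (leader-kernel a b) (rank-injective (leader-isLeader a) (leader-isLeader b)
      (inject≤-injective leaders≤j leaders≤j _ _ ca≡cb)))
    where
    open Enumeration (enumerate isLeader)
    c : Fin n → Fin _
    c a = inject≤ (rank (leader a) (leader-isLeader a)) leaders≤j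

  count-isLeader≤ : ∀ {j} (c : Fin n → Fin j) →
    (∀ a b → c a ≡ c b → entry M a b ≡ true ⊎ a ≡ b) → count isLeader ≤ j
  count-isLeader≤ c same-colour = count≤-injectiveOn isLeader c λ a b leader-a leader-b ca≡cb →
    [ isLeader-separated leader-a leader-b , id ] (same-colour a b ca≡cb)

complement-nonadjacent : ∀ {n} (G : SimpleGraph n) {a b} →
  adj G a b ≡ true → adj (complement G) a b ≡ false
complement-nonadjacent G ab rewrite ab = refl

adjacent-of-complement-nonadjacent : ∀ {n} (G : SimpleGraph n) {a b} → a ≢ b →
  adj (complement G) a b ≡ false → adj G a b ≡ true
adjacent-of-complement-nonadjacent G {a} {b} a≢b nonadjacent with adj G a b | a ≟ b
... | true  | _       = refl
... | false | yes a≡b = ⊥-elim (a≢b a≡b)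
... | false | no _    = case nonadjacent of λ ()

matching-irreflexive : ∀ {n} (G : SimpleGraph n) (M : Mat n) → IsMatching G M →
  ∀ a → entry M a a ≡ false
matching-irreflexive G M (_ , M⊆G , _) a =
  ¬-not {y = true} λ aa → case trans (sym (M⊆G a a aa)) (adj-irrefl G a) of λ ()

stablePartition-reflexive : ∀ {n} (H : SimpleGraph n) {j} (R : Mat n) → IsStablePartition H j R →
  ∀ a → entry R a a ≡ true
stablePartition-reflexive H R (_ , kernel , _) a = from (kernel a a) refl

matching⇒stablePartition : ∀ {n} (G : SimpleGraph n) {k} (M : Mat n) → IsMatching G M → k ≤ size M →
  IsStablePartition (complement G) (n ∸ k) (addDiagonal M)
matching⇒stablePartition {n} G M (M-sym , M⊆G , M-functional) k≤size =
  let c , c-kernel = colouring (≤-trans (≤-reflexive count-isLeader≡n∸size) (∸-monoʳ-≤ n k≤size))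
  in c , (λ a b → c-kernel a b ⇔-∘ entry-addDiagonal M a b)
       , (λ a b → independent ∘ from (c-kernel a b))
  where
  open Matching M M-sym M-functional
  independent : ∀ {a b} → entry M a b ≡ true ⊎ a ≡ b → adj (complement G) a b ≡ false
  independent {a} {b} (inj₁ ab)   = complement-nonadjacent G (M⊆G a b ab)
  independent {a}     (inj₂ refl) = adj-irrefl (complement G) a

module _ {n} (G : SimpleGraph n) {j} (R : Mat n) (partition : IsStablePartition (complement G) j R) where

  private
    F : Mat n
    F = removeDiagonal R

    c : Fin n → Fin j
    c = proj₁ partition

    kernel : ∀ a b → entry R a b ≡ true ⇔ c a ≡ c b
    kernel = proj₁ (proj₂ partition)

    independent : ∀ a b → c a ≡ c b → adj (complement G) a b ≡ false
    independent = proj₂ (proj₂ partition)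

    F-elim : ∀ {a b} → entry F a b ≡ true → c a ≡ c b × a ≢ b
    F-elim {a} {b} ab = let Rab , a≢b = to (entry-removeDiagonal R a b) ab in to (kernel a b) Rab , a≢b

    F-intro : ∀ {a b} → c a ≡ c b → a ≢ b → entry F a b ≡ true
    F-intro {a} {b} ca≡cb a≢b = from (entry-removeDiagonal R a b) (from (kernel a b) ca≡cb , a≢b)

    F-true-sym : ∀ {a b} → entry F a b ≡ true → entry F b a ≡ true
    F-true-sym ab = let ca≡cb , a≢b = F-elim ab in F-intro (sym ca≡cb) (a≢b ∘ sym)

    same-colour-adjacent : ∀ {a b} → c a ≡ c b → a ≢ b → adj G a b ≡ true
    same-colour-adjacent {a} {b} ca≡cb a≢b =
      adjacent-of-complement-nonadjacent G a≢b (independent a b ca≡cb)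

  stablePartition⇒matching : TriangleFree G → IsMatching G (removeDiagonal R)
  stablePartition⇒matching triangleFree = F-sym , F⊆G , F-functional
    where
    F-sym : ∀ a b → entry F a b ≡ entry F b a
    F-sym a b = Bool.⇔→≡ (mk⇔ F-true-sym F-true-sym)
    F⊆G : ∀ a b → entry F a b ≡ true → adj G a b ≡ true
    F⊆G a b ab = let ca≡cb , a≢b = F-elim ab in same-colour-adjacent ca≡cb a≢b
    F-functional : ∀ a b d → entry F a b ≡ true → entry F a d ≡ true → b ≡ d
    F-functional a b d ab ad with b ≟ d
    ... | yes b≡d = b≡d
    ... | no b≢d  =
      let ca≡cb , _ = F-elim ab ; ca≡cd , _ = F-elim ad
          bd = same-colour-adjacent (trans (sym ca≡cb) ca≡cd) b≢d
      in ⊥-elim (triangleFree a b d (F⊆G a b ab) bd (F⊆G a d ad))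

  stablePartition⇒size : IsMatching G (removeDiagonal R) → n ∸ j ≤ size (removeDiagonal R)
  stablePartition⇒size (F-sym , _ , F-functional) =
    ≤-trans (∸-monoʳ-≤ n (count-isLeader≤ c same-colour))
            (≤-reflexive (sym size≡n∸count-isLeader))
    where
    open Matching F F-sym F-functional
    same-colour : ∀ a b → c a ≡ c b → entry F a b ≡ true ⊎ a ≡ b
    same-colour a b ca≡cb with a ≟ b
    ... | yes a≡b = inj₂ a≡b
    ... | no a≢b  = inj₁ (F-intro ca≡cb a≢b)

ReconfGraph-≅ : ∀ {n} {P Q : Mat n → Set} (f g : Mat n → Mat n) →
  (∀ A → P A → Q (f A)) → (∀ B → Q B → P (g B)) →
  (∀ A → P A → g (f A) ≡ A) → (∀ B → Q B → f (g B) ≡ B) →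
  (∀ v A B → AgreeOff v A B → AgreeOff v (f A) (f B)) →
  (∀ v A B → AgreeOff v A B → AgreeOff v (g A) (g B)) →
  ReconfGraph P ≅ ReconfGraph Q
ReconfGraph-≅ f g f-resp g-resp g∘f f∘g f-agreeOff g-agreeOff = record
  { to        = λ (A , p) → f A , f-resp A p
  ; from      = λ (B , q) → g B , g-resp B q
  ; to-cong   = cong f
  ; from-cong = cong g
  ; from-to   = λ (A , p) → g∘f A p
  ; to-from   = λ (B , q) → f∘g B q
  ; adj-iff   = λ (A , p) (B , q) → mk⇔
      (λ (A≢B , v , agree) →
        (λ fA≡fB → A≢B (trans (sym (g∘f A p)) (trans (cong g fA≡fB) (g∘f B q))))
        , v , f-agreeOff v A B agree)
      (λ (fA≢fB , v , agree) →
        fA≢fB ∘ cong f , v , subst₂ (AgreeOff v) (g∘f A p) (g∘f B q) (g-agreeOff v (f A) (f B) agree))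
  }

proposition4p2 : (n : ℕ) (G : SimpleGraph n) → TriangleFree G →
    (k : ℕ) → 1 ≤ k → k < n →
    MatchingGraph G k ≅ BellGraph (complement G) (n ∸ k)
proposition4p2 n G triangleFree k _ k<n =
  ReconfGraph-≅ addDiagonal removeDiagonal
    (λ M (isMatching , k≤size) → matching⇒stablePartition G M isMatching k≤size)
    (λ R partition → let isMatching = stablePartition⇒matching G R partition triangleFree in
      isMatching , subst (_≤ size (removeDiagonal R)) (m∸[m∸n]≡n (<⇒≤ k<n))
                         (stablePartition⇒size G R partition isMatching))
    (λ M (isMatching , _) → removeDiagonal-addDiagonal M (matching-irreflexive G M isMatching))
    (λ R partition → addDiagonal-removeDiagonal R (stablePartition-reflexive (complement G) R partition))
    (pointwise-agreeOff orDiagonal)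
    (pointwise-agreeOff andOffDiagonal)
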